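{- Let $1\le\delta<\Delta$ be integers, let $\tilde h:\mathbb{Z}^+\to\mathbb{R}^+$ be a positive non-increasing function, $\mathcal{J}(G)=\sum_{u\in V(G)}\tilde h(d_u)$, and let $G$ be a graph with minimum degree $\delta$ and maximum degree $\Delta$. Then: (i) if $\delta$ is even, $\mathcal{J}(G)\ge\min\{\delta\tilde h(\Delta)+(\Delta-\delta)\tilde h(\Delta-1)+\tilde h(\delta),\ (\Delta+1)\tilde h(\Delta)+\tilde h(\delta)\}$; (ii) if either $\delta$ is odd and $\Delta$ is even, or $\delta\Delta$ is odd and $2\tilde h(\Delta)>\tilde h(\Delta-1)$, then $\mathcal{J}(G)\ge\min\{\delta\tilde h(\Delta)+(\Delta-\delta)\tilde h(\Delta-1)+\tilde h(\delta),\ \Delta\tilde h(\Delta)+\tilde h(\Delta-1)+\tilde h(\delta)\}$; (iii) if $\delta\Delta$ is odd and $2\tilde h(\Delta)\le\tilde h(\Delta-1)$, then $\mathcal{J}(G)\ge\min\{\delta\tilde h(\Delta)+(\Delta-\delta)\tilde h(\Delta-1)+\tilde h(\delta),\ (\Delta+2)\tilde h(\Delta)+\tilde h(\delta)\}$.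
   Context: All graphs are finite, simple and have at least one edge; $d_u$ denotes the degree of vertex $u$.
   Formalization: The function $\tilde h$ takes values in the positive rationals instead of $\mathbb{R}^+$. -}

module Defs where

open import Data.Nat using (ℕ; zero; suc; _≤_)
open import Data.Bool using (Bool; true; false; if_then_else_)
open import Data.Fin using (Fin)
open import Data.List using (List; map; allFin; foldr)
open import Data.Nat.ListAction using (sum)
open import Data.Integer using (+_)
open import Data.Rational using (ℚ; 0ℚ; _+_; _/_)
open import Relation.Binary.PropositionalEquality using (_≡_)
open import Data.Product using (_×_; ∃)

record Graph (n : ℕ) : Set where
  field
    adj     : Fin n → Fin n → Bool
    symm    : ∀ i j → adj i j ≡ adj j i
    irrefl  : ∀ i → adj i i ≡ false
open Graph public

deg : ∀ {n} → Graph n → Fin n → ℕ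
deg {n} G u = sum (map (λ v → if adj G u v then 1 else 0) (allFin n))

MinDegree : ∀ {n} → Graph n → ℕ → Set
MinDegree {n} G δ = (∃ λ (u : Fin n) → deg G u ≡ δ) × (∀ u → δ ≤ deg G u)

MaxDegree : ∀ {n} → Graph n → ℕ → Set
MaxDegree {n} G Δ = (∃ λ (u : Fin n) → deg G u ≡ Δ) × (∀ u → deg G u ≤ Δ)

ℕtoℚ : ℕ → ℚ
ℕtoℚ k = (+ k) / 1

J : ∀ {n} → (ℕ → ℚ) → Graph n → ℚ
J {n} h G = foldr _+_ 0ℚ (map (λ u → h (deg G u)) (allFin n))

{-# OPTIONS --safe #-}
-- Let u be a vertex of minimum degree δ.  There are n ≥ Δ + 1 vertices and each contributes at
-- least h(Δ) to J, so J ≥ h(δ) + (n − 1) h(Δ).  If n = Δ + 1, the Δ − δ vertices not adjacent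
-- to u have degree at most n − 2 = Δ − 1, which gives the first term of each minimum.
-- Otherwise, if every vertex other than u had degree Δ, the degree sum δ + (n − 1) Δ would be
-- even; the parity hypotheses make this impossible when n = Δ + 2 (and, for Δ even, for every n),
-- and a vertex v ≠ u of degree below Δ gives J ≥ h(δ) + h(Δ − 1) + (n − 2) h(Δ).  Comparing
-- h(Δ − 1) with 2 h(Δ) converts between the bounds Δ h(Δ) + h(Δ − 1) and (Δ + 2) h(Δ).
module Submission where

open import Defs
open import Algebra.Bundles using (CommutativeMonoid)
import Algebra.Properties.CommutativeMonoid.Sum as Summation
import Algebra.Properties.CommutativeSemigroup as CommutativeSemigroupProperties
import Algebra.Properties.Monoid.Mult as Multiplication
open import Data.Bool using (Bool; true; false; not; if_then_else_)
open import Data.Empty using (⊥-elim)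
open import Data.Fin using (Fin; zero; suc; punchIn; punchOut)
open import Data.Fin.Properties using (_≟_; punchInᵢ≢i; punchIn-punchOut; ¬∀⟶∃¬)
import Data.Integer as ℤ
open import Data.Integer.Properties using (+◃n≡+n)
open import Data.List using (map; foldr; tabulate)
open import Data.Nat using (ℕ; zero; suc; _∸_; z≤n; s≤s)
  renaming (_+_ to _+ℕ_; _≤_ to _≤ℕ_; _<_ to _<ℕ_; _*_ to _*ℕ_)
import Data.Nat.Properties as ℕ
open import Data.Nat.Coprimality as Coprime using (1-coprimeTo)
open import Data.Nat.Divisibility using (_∣_; divides; ∣m∣n⇒∣m+n; ∣m+n∣m⇒∣n; ∣m⇒∣m*n; ∣n⇒∣m*n)
open import Data.Nat.Solver using (module +-*-Solver)
open import Data.Product using (_×_; _,_; ∃-syntax)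
open import Data.Rational using (ℚ; 0ℚ; 1ℚ; mkℚ; _+_; _*_; _≤_; _<_; _⊓_)
import Data.Rational.Properties as ℚ
open import Data.Sum using (_⊎_; inj₁; inj₂; [_,_])
open import Data.Vec.Functional as Vector using (Vector; removeAt)
open import Function using (_∘_; id)
open import Relation.Binary.PropositionalEquality
  using (_≡_; _≢_; refl; sym; trans; cong; cong₂; subst; module ≡-Reasoning)
open import Relation.Nullary using (¬_)
open import Relation.Nullary.Decidable using (_⊎-dec_)

module ℕΣ = Summation ℕ.+-0-commutativeMonoid
module ℚΣ = Summation ℚ.+-0-commutativeMonoid
open ℚΣ using (sum)
open Multiplication ℚ.+-0-monoid using (×-homo-+) renaming (_×_ to _·_)
open CommutativeSemigroupProperties (CommutativeMonoid.commutativeSemigroup ℚ.+-0-commutativeMonoid)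
  using (x∙yz≈y∙xz)

foldr-map-tabulate : ∀ {A B : Set} (_∙_ : B → B → B) (e : B) {n} (f : A → B) (g : Fin n → A) →
                     foldr _∙_ e (map f (tabulate g)) ≡ Vector.foldr _∙_ e (f ∘ g)
foldr-map-tabulate _∙_ e {zero}  f g = refl
foldr-map-tabulate _∙_ e {suc n} f g = cong (f (g zero) ∙_) (foldr-map-tabulate _∙_ e f (g ∘ suc))

count : ∀ {m} → Vector Bool m → ℕ
count b = ℕΣ.sum (λ i → if b i then 1 else 0)

count≤length : ∀ {m} (b : Vector Bool m) → count b ≤ℕ m
count≤length {zero}  b = z≤n
count≤length {suc m} b with b zero
... | true  = s≤s (count≤length (b ∘ suc))
... | false = ℕ.m≤n⇒m≤1+n (count≤length (b ∘ suc))

count-removeAt : ∀ {m} (b : Vector Bool (suc m)) i → b i ≡ false → count b ≡ count (removeAt b i)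
count-removeAt b i bi≡false =
  trans (ℕΣ.sum-remove {i = i} (λ j → if b j then 1 else 0))
        (cong (λ c → (if c then 1 else 0) +ℕ count (removeAt b i)) bi≡false)

count<length : ∀ {m} (b : Vector Bool m) i → b i ≡ false → count b <ℕ m
count<length {suc m} b i bi≡false =
  subst (_<ℕ suc m) (sym (count-removeAt b i bi≡false)) (s≤s (count≤length _))

count+count-not : ∀ {m} (b : Vector Bool m) → count b +ℕ count (not ∘ b) ≡ m
count+count-not {zero}  b = refl
count+count-not {suc m} b with b zero
... | true  = cong suc (count+count-not (b ∘ suc))
... | false = trans (ℕ.+-suc _ _) (cong suc (count+count-not (b ∘ suc)))

sum-const : ∀ {m} {t : Vector ℕ m} {c} → (∀ i → t i ≡ c) → ℕΣ.sum t ≡ m *ℕ c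
sum-const {zero}  t≡c = refl
sum-const {suc m} t≡c = cong₂ _+ℕ_ (t≡c zero) (sum-const (t≡c ∘ suc))

above-diagonal : ∀ {n} → (Fin n → Fin n → ℕ) → ℕ
above-diagonal {zero}  a = 0
above-diagonal {suc n} a = ℕΣ.sum (λ j → a zero (suc j)) +ℕ above-diagonal (λ i j → a (suc i) (suc j))

sum-symmetric-hollow : ∀ {n} (a : Fin n → Fin n → ℕ) → (∀ i j → a i j ≡ a j i) → (∀ i → a i i ≡ 0) →
                       ℕΣ.sum (λ i → ℕΣ.sum (a i)) ≡ above-diagonal a +ℕ above-diagonal a
sum-symmetric-hollow {zero}  a symmetric hollow = refl
sum-symmetric-hollow {suc n} a symmetric hollow = begin
  (a zero zero +ℕ r) +ℕ ℕΣ.sum (λ i → a (suc i) zero +ℕ ℕΣ.sum (a′ i))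
    ≡⟨ cong₂ _+ℕ_ (cong (_+ℕ r) (hollow zero)) (ℕΣ.∑-distrib-+ (λ i → a (suc i) zero) (ℕΣ.sum ∘ a′)) ⟩
  r +ℕ (ℕΣ.sum (λ i → a (suc i) zero) +ℕ ℕΣ.sum (ℕΣ.sum ∘ a′))
    ≡⟨ cong₂ (λ c d → r +ℕ (c +ℕ d)) (ℕΣ.sum-cong-≗ (λ i → symmetric (suc i) zero))
             (sum-symmetric-hollow a′ (λ i j → symmetric (suc i) (suc j)) (hollow ∘ suc)) ⟩
  r +ℕ (r +ℕ (U +ℕ U))
    ≡⟨ solve 2 (λ r U → r :+ (r :+ (U :+ U)) := (r :+ U) :+ (r :+ U)) refl r U ⟩
  (r +ℕ U) +ℕ (r +ℕ U) ∎
  where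
  open ≡-Reasoning
  open +-*-Solver
  r  = ℕΣ.sum (λ j → a zero (suc j))
  a′ = λ i j → a (suc i) (suc j)
  U  = above-diagonal a′

2∣+-self : ∀ k → 2 ∣ k +ℕ k
2∣+-self k = divides k (trans (cong (k +ℕ_) (sym (ℕ.+-identityʳ k))) (ℕ.*-comm 2 k))

2∣suc-odd : ∀ {k} → ¬ 2 ∣ k → 2 ∣ suc k
2∣suc-odd {zero}        k-odd = ⊥-elim (k-odd (divides 0 refl))
2∣suc-odd {suc zero}    _     = divides 1 refl
2∣suc-odd {suc (suc k)} k-odd = ∣m∣n⇒∣m+n 2∣2 (2∣suc-odd (k-odd ∘ ∣m∣n⇒∣m+n 2∣2))
  where 2∣2 = divides 1 refl

odd-*⇒oddˡ : ∀ {a} b → ¬ 2 ∣ a *ℕ b → ¬ 2 ∣ a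
odd-*⇒oddˡ b ab-odd = ab-odd ∘ ∣m⇒∣m*n b

odd-*⇒oddʳ : ∀ a {b} → ¬ 2 ∣ a *ℕ b → ¬ 2 ∣ b
odd-*⇒oddʳ a ab-odd = ab-odd ∘ ∣n⇒∣m*n a

<⇒≤∸1 : ∀ {a b} → a <ℕ b → a ≤ℕ b ∸ 1
<⇒≤∸1 (s≤s a≤b) = a≤b

ℕtoℚ-suc : ∀ k → ℕtoℚ (suc k) ≡ 1ℚ + ℕtoℚ k
ℕtoℚ-suc k = trans 1+mkℚ (cong (1ℚ +_) (sym (ℚ.normalize-coprime k⊥1)))
  where
  k⊥1 = Coprime.sym (1-coprimeTo k)
  -- The numerator of the sum computes only as far as + 1 ℤ.+ (Sign.+ ◃ k * 1).
  1+mkℚ : ℕtoℚ (suc k) ≡ 1ℚ + mkℚ (ℤ.+ k) 0 k⊥1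
  1+mkℚ rewrite ℕ.*-identityʳ k | +◃n≡+n k = refl

ℕtoℚ*≡· : ∀ k p → ℕtoℚ k * p ≡ k · p
ℕtoℚ*≡· zero    p = ℚ.*-zeroˡ p
ℕtoℚ*≡· (suc k) p = begin
  ℕtoℚ (suc k) * p      ≡⟨ cong (_* p) (ℕtoℚ-suc k) ⟩
  (1ℚ + ℕtoℚ k) * p     ≡⟨ ℚ.*-distribʳ-+ p 1ℚ (ℕtoℚ k) ⟩
  1ℚ * p + ℕtoℚ k * p   ≡⟨ cong₂ _+_ (ℚ.*-identityˡ p) (ℕtoℚ*≡· k p) ⟩
  p + k · p             ∎
  where open ≡-Reasoning

ℕtoℚ-*-distribʳ-+ : ∀ a b p → ℕtoℚ (a +ℕ b) * p ≡ ℕtoℚ a * p + ℕtoℚ b * p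
ℕtoℚ-*-distribʳ-+ a b p = begin
  ℕtoℚ (a +ℕ b) * p        ≡⟨ ℕtoℚ*≡· (a +ℕ b) p ⟩
  (a +ℕ b) · p             ≡⟨ ×-homo-+ p a b ⟩
  a · p + b · p            ≡⟨ sym (cong₂ _+_ (ℕtoℚ*≡· a p) (ℕtoℚ*≡· b p)) ⟩
  ℕtoℚ a * p + ℕtoℚ b * p  ∎
  where open ≡-Reasoning

·-nonNeg : ∀ {c} → 0ℚ ≤ c → ∀ k → 0ℚ ≤ k · c
·-nonNeg c≥0 zero    = ℚ.≤-refl
·-nonNeg c≥0 (suc k) = ℚ.+-mono-≤ c≥0 (·-nonNeg c≥0 k)

·-monoˡ-≤ : ∀ {c k l} → 0ℚ ≤ c → k ≤ℕ l → k · c ≤ l · c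
·-monoˡ-≤ c≥0 (z≤n {l})  = ·-nonNeg c≥0 l
·-monoˡ-≤ {c} c≥0 (s≤s k≤l) = ℚ.+-monoʳ-≤ c (·-monoˡ-≤ c≥0 k≤l)

⊓-≤ˡ : ∀ {p r} q → p ≤ r → p ⊓ q ≤ r
⊓-≤ˡ {p} q = ℚ.≤-trans (ℚ.p⊓q≤p p q)

⊓-≤ʳ : ∀ p {q r} → q ≤ r → p ⊓ q ≤ r
⊓-≤ʳ p {q} = ℚ.≤-trans (ℚ.p⊓q≤q p q)

sum-if : ∀ {m} (b : Vector Bool m) p q →
         sum (λ i → if b i then p else q) ≡ count b · p + count (not ∘ b) · q
sum-if {zero}  b p q = refl
sum-if {suc m} b p q with b zero
... | true  = trans (cong (p +_) (sum-if (b ∘ suc) p q)) (sym (ℚ.+-assoc p _ _))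
... | false = trans (cong (q +_) (sum-if (b ∘ suc) p q)) (x∙yz≈y∙xz q (count (b ∘ suc) · p) _)

sum-mono-≤ : ∀ {m} {s t : Vector ℚ m} → (∀ i → s i ≤ t i) → sum s ≤ sum t
sum-mono-≤ {zero}  s≤t = ℚ.≤-refl
sum-mono-≤ {suc m} s≤t = ℚ.+-mono-≤ (s≤t zero) (sum-mono-≤ (s≤t ∘ suc))

·≤sum : ∀ {m} {c} {t : Vector ℚ m} → (∀ i → c ≤ t i) → m · c ≤ sum t
·≤sum {m} c≤t = ℚ.≤-trans (ℚ.≤-reflexive (sym (ℚΣ.sum-replicate m))) (sum-mono-≤ c≤t)

sum-removeAt-≥ : ∀ {m} (t : Vector ℚ (suc m)) i {a s} → a ≤ t i → s ≤ sum (removeAt t i) → a + s ≤ sum t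
sum-removeAt-≥ t i a≤ti s≤rest =
  ℚ.≤-trans (ℚ.+-mono-≤ a≤ti s≤rest) (ℚ.≤-reflexive (sym (ℚΣ.sum-remove t)))

sum-≥-point+const : ∀ {m} (t : Vector ℚ m) i {a c} → a ≤ t i → (∀ j → j ≢ i → c ≤ t j) →
                    a + (m ∸ 1) · c ≤ sum t
sum-≥-point+const {suc m} t i a≤ti c≤t =
  sum-removeAt-≥ t i a≤ti (·≤sum (λ j → c≤t (punchIn i j) (punchInᵢ≢i i j)))

deg≡count : ∀ {n} (G : Graph n) u → deg G u ≡ count (adj G u)
deg≡count G u = foldr-map-tabulate _+ℕ_ 0 (λ v → if adj G u v then 1 else 0) id

deg≡count-removeAt : ∀ {m} (G : Graph (suc m)) u → deg G u ≡ count (removeAt (adj G u) u)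
deg≡count-removeAt G u = trans (deg≡count G u) (count-removeAt (adj G u) u (irrefl G u))

deg<order : ∀ {n} (G : Graph n) v → deg G v <ℕ n
deg<order G v = subst (_<ℕ _) (sym (deg≡count G v)) (count<length (adj G v) v (irrefl G v))

deg-nonadjacent : ∀ {m} (G : Graph (suc m)) {u v} → v ≢ u → adj G u v ≡ false → deg G v <ℕ m
deg-nonadjacent G {u} {v} v≢u u≁v =
  subst (_<ℕ _) (sym (deg≡count-removeAt G v)) (count<length _ (punchOut v≢u) v≁u)
  where
  v≁u : adj G v (punchIn v (punchOut v≢u)) ≡ false
  v≁u = trans (cong (adj G v) (punchIn-punchOut v≢u)) (trans (symm G v u) u≁v)

handshake : ∀ {n} (G : Graph n) → 2 ∣ ℕΣ.sum (deg G)
handshake G =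
  subst (2 ∣_) (sym (trans (ℕΣ.sum-cong-≗ (deg≡count G)) (sum-symmetric-hollow a symmetric hollow)))
        (2∣+-self (above-diagonal a))
  where
  a = λ v w → if adj G v w then 1 else 0
  symmetric : ∀ v w → a v w ≡ a w v
  symmetric v w = cong (λ b → if b then 1 else 0) (symm G v w)
  hollow : ∀ v → a v v ≡ 0
  hollow v = cong (λ b → if b then 1 else 0) (irrefl G v)

almost-regular-parity : ∀ {m} (G : Graph (suc m)) {Δ} u → (∀ v → v ≢ u → deg G v ≡ Δ) →
                        2 ∣ m *ℕ Δ +ℕ deg G u
almost-regular-parity {m} G {Δ} u regular = subst (2 ∣_) degree-sum (handshake G)
  where
  degree-sum : ℕΣ.sum (deg G) ≡ m *ℕ Δ +ℕ deg G u
  degree-sum = begin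
    ℕΣ.sum (deg G)                     ≡⟨ ℕΣ.sum-remove (deg G) ⟩
    deg G u +ℕ ℕΣ.sum (removeAt (deg G) u)
      ≡⟨ cong (deg G u +ℕ_) (sum-const (λ i → regular (punchIn u i) (punchInᵢ≢i u i))) ⟩
    deg G u +ℕ m *ℕ Δ                  ≡⟨ ℕ.+-comm (deg G u) (m *ℕ Δ) ⟩
    m *ℕ Δ +ℕ deg G u                  ∎
    where open ≡-Reasoning

irregular-vertex : ∀ {m} (G : Graph (suc m)) {δ Δ} u → deg G u ≡ δ → (∀ v → deg G v ≤ℕ Δ) →
                   ¬ 2 ∣ δ → 2 ∣ m *ℕ Δ → ∃[ v ] v ≢ u × deg G v <ℕ Δ
irregular-vertex G {δ} {Δ} u deg-u≡δ deg≤Δ δ-odd 2∣mΔ =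
  let v , ¬[v≡u⊎deg≡Δ] = ¬∀⟶∃¬ _ (λ v → v ≡ u ⊎ deg G v ≡ Δ) (λ v → v ≟ u ⊎-dec deg G v ℕ.≟ Δ) ¬almost-regular
  in  v , ¬[v≡u⊎deg≡Δ] ∘ inj₁ , ℕ.≤∧≢⇒< (deg≤Δ v) (¬[v≡u⊎deg≡Δ] ∘ inj₂)
  where
  ¬almost-regular : ¬ (∀ v → v ≡ u ⊎ deg G v ≡ Δ)
  ¬almost-regular almost-regular =
    δ-odd (subst (2 ∣_) deg-u≡δ (∣m+n∣m⇒∣n (almost-regular-parity G u regular) 2∣mΔ))
    where
    regular : ∀ v → v ≢ u → deg G v ≡ Δ
    regular v v≢u = [ ⊥-elim ∘ v≢u , id ] (almost-regular v)

module LowerBounds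
  (h : ℕ → ℚ) (h-antitone : ∀ a b → 1 ≤ℕ a → a ≤ℕ b → h b ≤ h a)
  {m δ Δ : ℕ} (G : Graph (suc m)) (1≤δ : 1 ≤ℕ δ)
  (u : Fin (suc m)) (deg-u≡δ : deg G u ≡ δ) (δ≤deg : ∀ v → δ ≤ℕ deg G v) (deg≤Δ : ∀ v → deg G v ≤ℕ Δ)
  (Δ≤m : Δ ≤ℕ m) (0≤hΔ : 0ℚ ≤ h Δ)
  where

  open ℚ.≤-Reasoning

  J≡sum : J h G ≡ sum (h ∘ deg G)
  J≡sum = foldr-map-tabulate _+_ 0ℚ (h ∘ deg G) id

  h-deg-≥ : ∀ v {k} → deg G v ≤ℕ k → h k ≤ h (deg G v)
  h-deg-≥ v = h-antitone _ _ (ℕ.≤-trans 1≤δ (δ≤deg v))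

  hδ≤ : h δ ≤ h (deg G u)
  hδ≤ = ℚ.≤-reflexive (cong h (sym deg-u≡δ))

  hΔ≤ : ∀ v → h Δ ≤ h (deg G v)
  hΔ≤ v = h-deg-≥ v (deg≤Δ v)

  J-≥-max-degree : ∀ {k} → k ≤ℕ m → ℕtoℚ k * h Δ + h δ ≤ J h G
  J-≥-max-degree {k} k≤m = begin
    ℕtoℚ k * h Δ + h δ  ≡⟨ trans (cong (_+ h δ) (ℕtoℚ*≡· k (h Δ))) (ℚ.+-comm _ (h δ)) ⟩
    h δ + k · h Δ       ≤⟨ ℚ.+-monoʳ-≤ (h δ) (·-monoˡ-≤ 0≤hΔ k≤m) ⟩
    h δ + m · h Δ       ≤⟨ sum-≥-point+const (h ∘ deg G) u hδ≤ (λ v _ → hΔ≤ v) ⟩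
    sum (h ∘ deg G)     ≡⟨ sym J≡sum ⟩
    J h G               ∎

  J-≥-irregular : ∀ {k} → ¬ 2 ∣ δ → 2 ∣ m *ℕ Δ → k ≤ℕ m ∸ 1 → ℕtoℚ k * h Δ + h (Δ ∸ 1) + h δ ≤ J h G
  J-≥-irregular {k} δ-odd 2∣mΔ k≤m-1 with irregular-vertex G u deg-u≡δ deg≤Δ δ-odd 2∣mΔ
  ... | v , v≢u , deg<Δ = begin
    ℕtoℚ k * h Δ + h (Δ ∸ 1) + h δ     ≡⟨ cong (λ a → a + h (Δ ∸ 1) + h δ) (ℕtoℚ*≡· k (h Δ)) ⟩
    k · h Δ + h (Δ ∸ 1) + h δ          ≡⟨ trans (ℚ.+-comm _ (h δ)) (cong (h δ +_) (ℚ.+-comm _ (h (Δ ∸ 1)))) ⟩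
    h δ + (h (Δ ∸ 1) + k · h Δ)        ≤⟨ ℚ.+-monoʳ-≤ (h δ) (ℚ.+-monoʳ-≤ (h (Δ ∸ 1)) (·-monoˡ-≤ 0≤hΔ k≤m-1)) ⟩
    h δ + (h (Δ ∸ 1) + (m ∸ 1) · h Δ)  ≤⟨ sum-removeAt-≥ (h ∘ deg G) u hδ≤
                                            (sum-≥-point+const _ (punchOut u≢v) hΔ-1≤ (λ j _ → hΔ≤ (punchIn u j))) ⟩
    sum (h ∘ deg G)                    ≡⟨ sym J≡sum ⟩
    J h G                              ∎
    where
    u≢v = v≢u ∘ sym
    hΔ-1≤ : h (Δ ∸ 1) ≤ h (deg G (punchIn u (punchOut u≢v)))
    hΔ-1≤ = subst (λ w → h (Δ ∸ 1) ≤ h (deg G w)) (sym (punchIn-punchOut u≢v)) (h-deg-≥ v (<⇒≤∸1 deg<Δ))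

  J-≥-order≡Δ+1 : m ≡ Δ → ℕtoℚ δ * h Δ + ℕtoℚ (Δ ∸ δ) * h (Δ ∸ 1) + h δ ≤ J h G
  J-≥-order≡Δ+1 m≡Δ = begin
    ℕtoℚ δ * h Δ + ℕtoℚ (Δ ∸ δ) * h (Δ ∸ 1) + h δ
      ≡⟨ cong₂ (λ a b → a + b + h δ) (ℕtoℚ*≡· δ (h Δ)) (ℕtoℚ*≡· (Δ ∸ δ) (h (Δ ∸ 1))) ⟩
    δ · h Δ + (Δ ∸ δ) · h (Δ ∸ 1) + h δ
      ≡⟨ ℚ.+-comm _ (h δ) ⟩
    h δ + (δ · h Δ + (Δ ∸ δ) · h (Δ ∸ 1))
      ≡⟨ cong (h δ +_) (sym (trans (sum-if neighbour (h Δ) (h (Δ ∸ 1)))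
                                   (cong₂ (λ a b → a · h Δ + b · h (Δ ∸ 1)) count-neighbour count-non-neighbour))) ⟩
    h δ + sum (λ i → if neighbour i then h Δ else h (Δ ∸ 1))
      ≤⟨ sum-removeAt-≥ (h ∘ deg G) u hδ≤ (sum-mono-≤ pointwise) ⟩
    sum (h ∘ deg G)
      ≡⟨ sym J≡sum ⟩
    J h G ∎
    where
    neighbour = removeAt (adj G u) u
    pointwise : ∀ i → (if neighbour i then h Δ else h (Δ ∸ 1)) ≤ h (deg G (punchIn u i))
    pointwise i with adj G u (punchIn u i) in u≁v
    ... | true  = hΔ≤ (punchIn u i)
    ... | false = h-deg-≥ _ (<⇒≤∸1 (subst (_ <ℕ_) m≡Δ (deg-nonadjacent G (punchInᵢ≢i u i) u≁v)))
    count-neighbour : count neighbour ≡ δ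
    count-neighbour = trans (sym (deg≡count-removeAt G u)) deg-u≡δ
    count-non-neighbour : count (not ∘ neighbour) ≡ Δ ∸ δ
    count-non-neighbour = trans (sym (ℕ.m+n∸m≡n (count neighbour) _))
                                (cong₂ _∸_ (trans (count+count-not neighbour) m≡Δ) count-neighbour)

  J-≥-odd-order≡Δ+2 : ¬ 2 ∣ δ *ℕ Δ → suc Δ ≡ m → ℕtoℚ Δ * h Δ + h (Δ ∸ 1) + h δ ≤ J h G
  J-≥-odd-order≡Δ+2 δΔ-odd 1+Δ≡m =
    J-≥-irregular (odd-*⇒oddˡ Δ δΔ-odd)
                  (subst (λ k → 2 ∣ k *ℕ Δ) 1+Δ≡m (∣m⇒∣m*n Δ (2∣suc-odd (odd-*⇒oddʳ δ δΔ-odd))))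
                  (ℕ.≤-reflexive (cong (_∸ 1) 1+Δ≡m))

  T₁ : ℚ
  T₁ = ℕtoℚ δ * h Δ + ℕtoℚ (Δ ∸ δ) * h (Δ ∸ 1) + h δ

  bound-i : T₁ ⊓ (ℕtoℚ (Δ +ℕ 1) * h Δ + h δ) ≤ J h G
  bound-i with ℕ.m≤n⇒m<n∨m≡n Δ≤m
  ... | inj₂ Δ≡m = ⊓-≤ˡ _ (J-≥-order≡Δ+1 (sym Δ≡m))
  ... | inj₁ Δ<m = ⊓-≤ʳ T₁ (J-≥-max-degree (subst (_≤ℕ m) (ℕ.+-comm 1 Δ) Δ<m))

  bound-ii : (¬ 2 ∣ δ × 2 ∣ Δ) ⊎ (¬ 2 ∣ δ *ℕ Δ × h (Δ ∸ 1) < ℕtoℚ 2 * h Δ) →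
             T₁ ⊓ (ℕtoℚ Δ * h Δ + h (Δ ∸ 1) + h δ) ≤ J h G
  bound-ii parity with ℕ.m≤n⇒m<n∨m≡n Δ≤m
  ... | inj₂ Δ≡m = ⊓-≤ˡ _ (J-≥-order≡Δ+1 (sym Δ≡m))
  ... | inj₁ Δ<m = ⊓-≤ʳ T₁ (by-parity parity)
    where
    by-parity : (¬ 2 ∣ δ × 2 ∣ Δ) ⊎ (¬ 2 ∣ δ *ℕ Δ × h (Δ ∸ 1) < ℕtoℚ 2 * h Δ) →
                ℕtoℚ Δ * h Δ + h (Δ ∸ 1) + h δ ≤ J h G
    by-parity (inj₁ (δ-odd , 2∣Δ)) = J-≥-irregular δ-odd (∣n⇒∣m*n m 2∣Δ) (<⇒≤∸1 Δ<m)
    by-parity (inj₂ (δΔ-odd , hΔ-1<2hΔ)) with ℕ.m≤n⇒m<n∨m≡n Δ<m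
    ... | inj₂ 1+Δ≡m = J-≥-odd-order≡Δ+2 δΔ-odd 1+Δ≡m
    ... | inj₁ 1+Δ<m = begin
      ℕtoℚ Δ * h Δ + h (Δ ∸ 1) + h δ      ≤⟨ ℚ.+-monoˡ-≤ (h δ) (ℚ.+-monoʳ-≤ (ℕtoℚ Δ * h Δ) (ℚ.<⇒≤ hΔ-1<2hΔ)) ⟩
      ℕtoℚ Δ * h Δ + ℕtoℚ 2 * h Δ + h δ  ≡⟨ cong (_+ h δ) (sym (ℕtoℚ-*-distribʳ-+ Δ 2 (h Δ))) ⟩
      ℕtoℚ (Δ +ℕ 2) * h Δ + h δ          ≤⟨ J-≥-max-degree (subst (_≤ℕ m) (ℕ.+-comm 2 Δ) 1+Δ<m) ⟩
      J h G                               ∎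

  bound-iii : ¬ 2 ∣ δ *ℕ Δ × ℕtoℚ 2 * h Δ ≤ h (Δ ∸ 1) → T₁ ⊓ (ℕtoℚ (Δ +ℕ 2) * h Δ + h δ) ≤ J h G
  bound-iii (δΔ-odd , 2hΔ≤hΔ-1) with ℕ.m≤n⇒m<n∨m≡n Δ≤m
  ... | inj₂ Δ≡m = ⊓-≤ˡ _ (J-≥-order≡Δ+1 (sym Δ≡m))
  ... | inj₁ Δ<m with ℕ.m≤n⇒m<n∨m≡n Δ<m
  ...   | inj₁ 1+Δ<m = ⊓-≤ʳ T₁ (J-≥-max-degree (subst (_≤ℕ m) (ℕ.+-comm 2 Δ) 1+Δ<m))
  ...   | inj₂ 1+Δ≡m = ⊓-≤ʳ T₁ (begin
      ℕtoℚ (Δ +ℕ 2) * h Δ + h δ          ≡⟨ cong (_+ h δ) (ℕtoℚ-*-distribʳ-+ Δ 2 (h Δ)) ⟩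
      ℕtoℚ Δ * h Δ + ℕtoℚ 2 * h Δ + h δ  ≤⟨ ℚ.+-monoˡ-≤ (h δ) (ℚ.+-monoʳ-≤ (ℕtoℚ Δ * h Δ) 2hΔ≤hΔ-1) ⟩
      ℕtoℚ Δ * h Δ + h (Δ ∸ 1) + h δ      ≤⟨ J-≥-odd-order≡Δ+2 δΔ-odd 1+Δ≡m ⟩
      J h G                               ∎)

theorem2p17 : (δ Δ : ℕ) → 1 ≤ℕ δ → δ <ℕ Δ →
    (h : ℕ → ℚ) →
    (∀ k → 1 ≤ℕ k → 0ℚ < h k) →
    (∀ a b → 1 ≤ℕ a → a ≤ℕ b → h b ≤ h a) →
    (n : ℕ) (G : Graph n) → MinDegree G δ → MaxDegree G Δ →
    ((2 ∣ δ) →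
      (ℕtoℚ δ * h Δ + ℕtoℚ (Δ ∸ δ) * h (Δ ∸ 1) + h δ)
        ⊓ (ℕtoℚ (Δ +ℕ 1) * h Δ + h δ) ≤ J h G)
    × (((¬ (2 ∣ δ) × (2 ∣ Δ)) ⊎ (¬ (2 ∣ (δ *ℕ Δ)) × ((h (Δ ∸ 1)) < (ℕtoℚ 2 * h Δ)))) →
      (ℕtoℚ δ * h Δ + ℕtoℚ (Δ ∸ δ) * h (Δ ∸ 1) + h δ)
        ⊓ (ℕtoℚ Δ * h Δ + h (Δ ∸ 1) + h δ) ≤ J h G)
    × ((¬ (2 ∣ (δ *ℕ Δ)) × (ℕtoℚ 2 * h Δ ≤ h (Δ ∸ 1))) →
      (ℕtoℚ δ * h Δ + ℕtoℚ (Δ ∸ δ) * h (Δ ∸ 1) + h δ)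
        ⊓ (ℕtoℚ (Δ +ℕ 2) * h Δ + h δ) ≤ J h G)
theorem2p17 δ Δ 1≤δ δ<Δ h h>0 h-antitone zero    G ((() , _) , _) _
theorem2p17 δ Δ 1≤δ δ<Δ h h>0 h-antitone (suc m) G ((u , deg-u≡δ) , δ≤deg) ((w , deg-w≡Δ) , deg≤Δ) =
  -- Bound (i) holds whatever the parity of δ.
  (λ _ → bound-i) , bound-ii , bound-iii
  where
  open LowerBounds h h-antitone G 1≤δ u deg-u≡δ δ≤deg deg≤Δ
         (ℕ.≤-pred (subst (_<ℕ suc m) deg-w≡Δ (deg<order G w)))
         (ℚ.<⇒≤ (h>0 Δ (ℕ.≤-trans 1≤δ (ℕ.<⇒≤ δ<Δ))))
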